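{- Let $(L,(W_t:t\in L))$ be a line-decomposition of a graph $G$, and let $S_1,S_2$ be distinct splits of the same size. Then either $S_1$ is before $S_2$, or $S_2$ is before $S_1$.
   Context: Graphs may be infinite. A line is a nonempty set $L$ with a linear order $\le_L$. A line-decomposition of $G$ is a pair $(L,(W_t:t\in L))$ with $L$ a line and $W_t\subseteq V(G)$, such that $G=\bigcup_{t\in L}G[W_t]$ and $W_t\cap W_{t''}\subseteq W_{t'}$ whenever $t\le_L t'\le_L t''$. An interval of $L$ is a nonempty $I\subseteq L$ such that $r\le_L s\le_L t$ and $r,t\in I$ imply $s\in I$. An interval $I$ is initial if $I\ne L$ and for all $s\le_L t$, $t\in I$ implies $s\in I$. For an interval $I$, $W(I)=\bigcup_{t\in I}W_t$. For an initial interval $I$, the $I$-split is $W(I)\cap W(L\setminus I)$; a set $X$ is a split if it is the $I$-split for some initial interval $I$. For splits $S_1,S_2$, $S_1$ is before $S_2$ if $I_1\subseteq I_2$ for all initial intervals $I_1,I_2$ such that $S_1$ is the $I_1$-split and $S_2$ is the $I_2$-split.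
   Formalization: The splits $S_1,S_2$ are both finite with the same number of elements, so same size means equal finite cardinality. The statement above fails without it. -}

module Defs where

open import Level using (0ℓ)
open import Data.Nat using (ℕ)
open import Data.Product using (Σ; ∃; _×_; _,_)
open import Data.List using (List; length)
open import Data.List.Relation.Unary.Unique.Propositional using (Unique)
import Data.List.Membership.Propositional as LM
open import Relation.Nullary using (¬_)
open import Relation.Unary using (Pred; _∈_; _∉_; _⊆_; _≐_; _∩_; ∁)
open import Relation.Binary.PropositionalEquality using (_≡_)
open import Relation.Binary.Structures using (IsTotalOrder)

record Graph : Set₁ where
  field
    V     : Set
    E     : V → V → Set
    E-sym : ∀ {u v} → E u v → E v u
    E-irr : ∀ {v} → ¬ E v v

record Line : Set₁ where
  field
    Pt       : Set
    _≤_      : Pt → Pt → Set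
    isTotal  : IsTotalOrder _≡_ _≤_
    nonempty : Pt

record LineDecomposition (G : Graph) (L : Line) : Set₁ where
  open Graph G
  open Line L
  field
    W         : Pt → Pred V 0ℓ
    cover-V   : ∀ v → ∃ λ t → v ∈ W t
    cover-E   : ∀ u v → E u v → ∃ λ t → u ∈ W t × v ∈ W t
    interpol  : ∀ t t′ t″ → t ≤ t′ → t′ ≤ t″ → (W t ∩ W t″) ⊆ W t′

module _ {L : Line} where
  open Line L

  IsInterval : Pred Pt 0ℓ → Set
  IsInterval I = (∃ λ t → t ∈ I)
               × (∀ r s t → r ≤ s → s ≤ t → r ∈ I → t ∈ I → s ∈ I)

  IsInitial : Pred Pt 0ℓ → Set
  IsInitial I = IsInterval I
              × ¬ (∀ t → t ∈ I)
              × (∀ s t → s ≤ t → t ∈ I → s ∈ I)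

module _ {G : Graph} {L : Line} (D : LineDecomposition G L) where
  open Graph G
  open Line L
  open LineDecomposition D

  WI : Pred Pt 0ℓ → Pred V 0ℓ
  WI I v = ∃ λ t → t ∈ I × v ∈ W t

  split : Pred Pt 0ℓ → Pred V 0ℓ
  split I = WI I ∩ WI (∁ I)

  IsSplitOf : Pred V 0ℓ → Pred Pt 0ℓ → Set
  IsSplitOf X I = IsInitial {L} I × (X ≐ split I)

  IsSplit : Pred V 0ℓ → Set₁
  IsSplit X = ∃ λ (I : Pred Pt 0ℓ) → IsSplitOf X I

  Before : Pred V 0ℓ → Pred V 0ℓ → Set₁
  Before S₁ S₂ = ∀ (I₁ I₂ : Pred Pt 0ℓ) → IsSplitOf S₁ I₁ → IsSplitOf S₂ I₂ → I₁ ⊆ I₂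

HasSize : {A : Set} → Pred A 0ℓ → ℕ → Set
HasSize {A} X n = Σ (List A) λ xs →
  length xs ≡ n × Unique xs × (∀ a → (a ∈ X → a LM.∈ xs) × (a LM.∈ xs → a ∈ X))

{-# OPTIONS --safe #-}
-- Initial intervals of a line are totally ordered by inclusion, so two splits S₁, S₂ have
-- representatives A₁ ⊆ A₂, say. If some other representatives I₁, I₂ had I₂ ⊊ I₁, then
-- comparing A₁ with I₂ puts one representative of S₂ between two of S₁ or vice versa;
-- a vertex of the splits at both ends lies on both sides of the middle cut, so one split
-- contains the other. Two finite sets of the same size, one inside the other, are equal.
module Submission where

open import Defs
open import Level using (0ℓ)
open import Data.Nat as ℕ using (ℕ; suc)
open import Data.Nat.Properties using (n≮n)
open import Data.Sum as Sum using (_⊎_; inj₁; inj₂)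
open import Data.Product using (_,_; proj₁; proj₂; swap)
open import Data.List using (List; _∷_; length)
open import Data.List.Relation.Unary.Any using (here; there)
open import Data.List.Relation.Unary.All using (All; tabulate)
open import Data.List.Relation.Unary.AllPairs using ([]; _∷_)
open import Data.List.Relation.Unary.Unique.Propositional using (Unique)
open import Data.List.Relation.Binary.Subset.Propositional using () renaming (_⊆_ to _⊆ₗ_)
import Data.List.Membership.Propositional as List
import Data.List.Fresh as List#
import Data.List.Fresh.Relation.Unary.Any as Any#
import Data.List.Fresh.Membership.Setoid as Membership#
import Data.List.Fresh.Membership.Setoid.Properties as Membership#ₚ
open import Data.Empty using (⊥-elim)
open import Function using (_∘_)
open import Relation.Nullary using (¬_; yes; no; contradiction)
open import Relation.Nullary.Decidable using (decidable-stable)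
open import Relation.Unary using (Pred; _≐_; _⊆_; _⊈_; _∈_; _∉_; _∩_)
open import Relation.Binary.PropositionalEquality
  using (_≡_; _≢_; refl; cong; subst; subst₂; setoid)
open import Relation.Binary.Structures using (IsTotalOrder)
open import Axiom.ExcludedMiddle using (ExcludedMiddle)

module _ {A : Set} where
  open Membership# (setoid A) using () renaming (_∈_ to _∈#_)

  private
    fresh : {xs : List A} → Unique xs → List#.List# A _≢_
    fresh = List#.fromList

    length-fresh : {xs : List A} (u : Unique xs) → List#.length (fresh u) ≡ length xs
    length-fresh []      = refl
    length-fresh (_ ∷ u) = cong suc (length-fresh u)

    ∈-fresh⁺ : ∀ {x xs} (u : Unique xs) → x List.∈ xs → x ∈# fresh u
    ∈-fresh⁺ (_ ∷ u) (here x≡y) = Any#.here x≡y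
    ∈-fresh⁺ (_ ∷ u) (there x∈) = Any#.there (∈-fresh⁺ u x∈)

    ∈-fresh⁻ : ∀ {x xs} (u : Unique xs) → x ∈# fresh u → x List.∈ xs
    ∈-fresh⁻ (_ ∷ u) (Any#.here x≡y) = here x≡y
    ∈-fresh⁻ (_ ∷ u) (Any#.there x∈) = there (∈-fresh⁻ u x∈)

  Unique-⊆⇒length≤ : {xs ys : List A} → Unique xs → Unique ys → xs ⊆ₗ ys →
                     length xs ℕ.≤ length ys
  Unique-⊆⇒length≤ u v xs⊆ys =
    subst₂ ℕ._≤_ (length-fresh u) (length-fresh v)
      (Membership#ₚ.injection (setoid A) (λ x≢y → x≢y) (∈-fresh⁺ v ∘ xs⊆ys ∘ ∈-fresh⁻ u))

  HasSize-⊆⇒≐ : ExcludedMiddle 0ℓ → {X Y : Pred A 0ℓ} {n : ℕ} →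
                HasSize X n → HasSize Y n → X ⊆ Y → X ≐ Y
  HasSize-⊆⇒≐ em {X} {Y} {n} (xs , refl , uxs , xs≈X) (ys , |ys|≡n , uys , ys≈Y) X⊆Y =
    X⊆Y , λ y∈Y → decidable-stable em (Y∖X-empty y∈Y)
    where
    xs⊆X : ∀ {x} → x List.∈ xs → x ∈ X
    xs⊆X {x} = proj₂ (xs≈X x)

    y∷xs⊆ys : ∀ {y} → y ∈ Y → (y ∷ xs) ⊆ₗ ys
    y∷xs⊆ys {y} y∈Y (here refl)      = proj₁ (ys≈Y y) y∈Y
    y∷xs⊆ys     _   {x} (there x∈xs) = proj₁ (ys≈Y x) (X⊆Y (xs⊆X x∈xs))

    Y∖X-empty : ∀ {y} → y ∈ Y → ¬ (y ∉ X)
    Y∖X-empty {y} y∈Y y∉X = n≮n n (subst (suc n ℕ.≤_) |ys|≡n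
      (Unique-⊆⇒length≤ (y∉xs ∷ uxs) uys (y∷xs⊆ys y∈Y)))
      where
      y∉xs : All (y ≢_) xs
      y∉xs = tabulate λ { x∈xs refl → y∉X (xs⊆X x∈xs) }

module _ {L : Line} where
  open Line L

  IsDownClosed : Pred Pt 0ℓ → Set
  IsDownClosed I = ∀ s t → s ≤ t → t ∈ I → s ∈ I

  module _ (em : ExcludedMiddle 0ℓ) where

    downClosed-⊆-total : {I J : Pred Pt 0ℓ} → IsDownClosed I → IsDownClosed J →
                         I ⊆ J ⊎ J ⊆ I
    downClosed-⊆-total {I} {J} I↓ J↓ with em {I ⊆ J}
    ... | yes I⊆J = inj₁ I⊆J
    ... | no  I⊈J = inj₂ (λ s∈J → decidable-stable em (I⊈J ∘ J∖I⇒I⊆J s∈J))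
      where
      J∖I⇒I⊆J : ∀ {s} → s ∈ J → s ∉ I → I ⊆ J
      J∖I⇒I⊆J {s} s∈J s∉I {t} t∈I with IsTotalOrder.total isTotal s t
      ... | inj₁ s≤t = contradiction (I↓ s t s≤t t∈I) s∉I
      ... | inj₂ t≤s = J↓ t s t≤s s∈J

    initial-⊆-total : {I J : Pred Pt 0ℓ} → IsInitial {L} I → IsInitial {L} J →
                      I ⊆ J ⊎ J ⊆ I
    initial-⊆-total (_ , _ , I↓) (_ , _ , J↓) = downClosed-⊆-total I↓ J↓

module _ {G : Graph} {L : Line} (D : LineDecomposition G L) where
  open Graph G
  open Line L

  split-between : {I J K : Pred Pt 0ℓ} → I ⊆ J → J ⊆ K → split D I ∩ split D K ⊆ split D J
  split-between I⊆J J⊆K (((t , t∈I , v∈Wt) , _) , (_ , (t′ , t′∉K , v∈Wt′))) =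
    (t , I⊆J t∈I , v∈Wt) , (t′ , t′∉K ∘ J⊆K , v∈Wt′)

  splitOf-between : {S S′ : Pred V 0ℓ} {I J K : Pred Pt 0ℓ} → I ⊆ J → J ⊆ K →
                    IsSplitOf D S I → IsSplitOf D S K → IsSplitOf D S′ J → S ⊆ S′
  splitOf-between I⊆J J⊆K (_ , S≐I) (_ , S≐K) (_ , S′≐J) v∈S =
    proj₂ S′≐J (split-between I⊆J J⊆K (proj₁ S≐I v∈S , proj₁ S≐K v∈S))

  module _ (em : ExcludedMiddle 0ℓ) where

    incomparable-⊆⇒Before : {S₁ S₂ : Pred V 0ℓ} {A₁ A₂ : Pred Pt 0ℓ} →
                            IsSplitOf D S₁ A₁ → IsSplitOf D S₂ A₂ → A₁ ⊆ A₂ →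
                            S₁ ⊈ S₂ → S₂ ⊈ S₁ → Before D S₁ S₂
    incomparable-⊆⇒Before S₁⟨A₁⟩ S₂⟨A₂⟩ A₁⊆A₂ S₁⊈S₂ S₂⊈S₁ I₁ I₂ S₁⟨I₁⟩ S₂⟨I₂⟩
      with initial-⊆-total {L} em (proj₁ S₁⟨I₁⟩) (proj₁ S₂⟨I₂⟩)
    ... | inj₁ I₁⊆I₂ = I₁⊆I₂
    ... | inj₂ I₂⊆I₁ with initial-⊆-total {L} em (proj₁ S₁⟨A₁⟩) (proj₁ S₂⟨I₂⟩)
    ...   | inj₁ A₁⊆I₂ = ⊥-elim (S₁⊈S₂ (splitOf-between A₁⊆I₂ I₂⊆I₁ S₁⟨A₁⟩ S₁⟨I₁⟩ S₂⟨I₂⟩))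
    ...   | inj₂ I₂⊆A₁ = ⊥-elim (S₂⊈S₁ (splitOf-between I₂⊆A₁ A₁⊆A₂ S₂⟨I₂⟩ S₂⟨A₂⟩ S₁⟨A₁⟩))

mainTheorem4 : ExcludedMiddle 0ℓ →
    (G : Graph) (L : Line) (D : LineDecomposition G L)
    (S₁ S₂ : Pred (Graph.V G) 0ℓ) →
    IsSplit D S₁ → IsSplit D S₂ → ¬ (S₁ ≐ S₂) →
    (n : ℕ) → HasSize S₁ n → HasSize S₂ n →
    Before D S₁ S₂ ⊎ Before D S₂ S₁
mainTheorem4 em G L D S₁ S₂ (A₁ , S₁⟨A₁⟩) (A₂ , S₂⟨A₂⟩) S₁≉S₂ n |S₁| |S₂| =
  Sum.map (λ (A₁⊆A₂ : A₁ ⊆ A₂) → incomparable-⊆⇒Before D em S₁⟨A₁⟩ S₂⟨A₂⟩ A₁⊆A₂ S₁⊈S₂ S₂⊈S₁)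
          (λ (A₂⊆A₁ : A₂ ⊆ A₁) → incomparable-⊆⇒Before D em S₂⟨A₂⟩ S₁⟨A₁⟩ A₂⊆A₁ S₂⊈S₁ S₁⊈S₂)
          (initial-⊆-total {L} em (proj₁ S₁⟨A₁⟩) (proj₁ S₂⟨A₂⟩))
  where
  S₁⊈S₂ : S₁ ⊈ S₂
  S₁⊈S₂ = S₁≉S₂ ∘ HasSize-⊆⇒≐ em |S₁| |S₂|

  S₂⊈S₁ : S₂ ⊈ S₁
  S₂⊈S₁ = S₁≉S₂ ∘ swap ∘ HasSize-⊆⇒≐ em |S₂| |S₁|
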